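{- Let $p$ be a string over a finite alphabet, and suppose $b$ is a nonempty string with $b\ne p$, $b$ both a prefix and suffix of $p$, $|b|>|p|/2$, such that $p(b)$ has property 1. Then there exists a nonempty string $b'\neq p$ that is both a prefix and a suffix of $p$, with $|b'|\le |p|/2$, such that $p(b')$ has property 1.
   Context: Strings are indexed from 1. For a nonempty string $b\neq p$ that is both a prefix and a suffix of $p$, $p(b)$ denotes $ubv$ where $ub=bv=p$. We say $p(b)$ has property 1 if $p(b)$ has a substring $p'=p(b)[i+1..i+|p|]$ with $0<i<|p(b)|-|p|$ (a length-$|p|$ substring which is neither the prefix nor the suffix of $p(b)$) that differs from $p$ in at most two positions (Hamming distance at most 2). -}

module Defs where

open import Data.Nat using (ℕ; zero; suc; _+_; _*_; _≤_; _<_)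
open import Data.Fin using (Fin)
open import Data.Fin.Properties using (_≟_)
open import Data.List using (List; []; _∷_; _++_; length; take; drop)
open import Data.Product using (Σ; ∃; _×_; _,_)
open import Relation.Binary.PropositionalEquality using (_≡_)
open import Relation.Nullary using (¬_; yes; no)

Str : ℕ → Set
Str k = List (Fin k)

-- Number of positions where two strings differ (compared position by position;
-- used only on strings of equal length).
hamming : ∀ {k} → Str k → Str k → ℕ
hamming []       _        = 0
hamming (_ ∷ _)  []       = 0
hamming (x ∷ xs) (y ∷ ys) with x ≟ y
... | yes _ = hamming xs ys
... | no  _ = suc (hamming xs ys)

IsBorder : ∀ {k} → Str k → Str k → Set
IsBorder p b = ¬ (b ≡ []) × ¬ (b ≡ p) × (∃ λ v → b ++ v ≡ p) × (∃ λ u → u ++ b ≡ p)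

-- p(b) = u b v where u b = b v = p; since u b = p, this is u ++ p.
-- PB p b w : w is p(b) (u is uniquely determined by u ++ b ≡ p).
PB : ∀ {k} → Str k → Str k → Str k → Set
PB p b w = ∃ λ u → (u ++ b ≡ p) × (w ≡ u ++ p)

-- Property 1 of the string w = p(b) relative to p: some length-|p| substring
-- w[i+1..i+|p|] with 0 < i < |w| - |p| is at Hamming distance ≤ 2 from p.
Property1 : ∀ {k} → Str k → Str k → Set
Property1 p w = ∃ λ i → (0 < i) × (i + length p < length w)
                  × (hamming (take (length p) (drop i w)) p ≤ 2)

module Submission where

open import Defs
open import Data.Nat using (ℕ; zero; suc; _+_; _*_; _∸_; _≤_; _<_; _≤?_; z≤n; s≤s)
open import Data.Nat.Properties
open import Data.List using (List; []; _∷_; _++_; length; take; drop)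
open import Data.List.Properties using (length-++; length-++-≤ˡ; ++-assoc; ++-identityʳ; length-take; take++drop≡id)
open import Data.Product using (∃; _×_; _,_)
open import Relation.Binary.PropositionalEquality
open import Relation.Nullary using (¬_; yes; no; contradiction)

-- A border b = p[1..n-q] means p has period q: u p = p v with |u| = |v| = q.  Then u^j
-- is a period as long as jq < n, so p has a border of length n - jq, and p(that border)
-- = u^j p extends p(b) = u p, hence still contains its near-occurrence of p.  Choosing
-- j with n ≤ 2jq makes the new border at most half of p.

module _ {A : Set} where

  _^_ : List A → ℕ → List A
  u ^ zero  = []
  u ^ suc j = u ++ u ^ j

  length-^ : ∀ (u : List A) j → length (u ^ j) ≡ j * length u
  length-^ u zero    = refl
  length-^ u (suc j) = trans (length-++ u) (cong (length u +_) (length-^ u j))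

  length-take-≤ : ∀ {n} {xs : List A} → n ≤ length xs → length (take n xs) ≡ n
  length-take-≤ {n} {xs} n≤xs = trans (length-take n xs) (m≤n⇒m⊓n≡m n≤xs)

  take-length-++ : ∀ (xs ys : List A) → take (length xs) (xs ++ ys) ≡ xs
  take-length-++ []       ys = refl
  take-length-++ (x ∷ xs) ys = cong (x ∷_) (take-length-++ xs ys)

  take-length+-++ : ∀ (xs ys : List A) k → take (length xs + k) (xs ++ ys) ≡ xs ++ take k ys
  take-length+-++ []       ys k = refl
  take-length+-++ (x ∷ xs) ys k = cong (x ∷_) (take-length+-++ xs ys k)

  take-drop-++ˡ : ∀ i n (xs ys : List A) → i + n ≤ length xs
                → take n (drop i (xs ++ ys)) ≡ take n (drop i xs)
  take-drop-++ˡ zero    zero    xs       ys _       = refl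
  take-drop-++ˡ zero    (suc n) (x ∷ xs) ys (s≤s h) = cong (x ∷_) (take-drop-++ˡ zero n xs ys h)
  take-drop-++ˡ (suc i) n       (x ∷ xs) ys (s≤s h) = take-drop-++ˡ i n xs ys h

  ≢[]⇒0<length : ∀ {xs : List A} → ¬ xs ≡ [] → 0 < length xs
  ≢[]⇒0<length {[]}    xs≢[] = contradiction refl xs≢[]
  ≢[]⇒0<length {_ ∷ _} _     = s≤s z≤n

  border⇒period : ∀ {p b u v : List A} → b ++ v ≡ p → u ++ b ≡ p → u ++ p ≡ p ++ v
  border⇒period {p} {b} {u} {v} bv≡p ub≡p = begin
    u ++ p         ≡⟨ cong (u ++_) bv≡p ⟨
    u ++ (b ++ v)  ≡⟨ ++-assoc u b v ⟨
    (u ++ b) ++ v  ≡⟨ cong (_++ v) ub≡p ⟩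
    p ++ v         ∎
    where open ≡-Reasoning

  period-^ : ∀ {p u v : List A} → u ++ p ≡ p ++ v → ∀ j → u ^ j ++ p ≡ p ++ v ^ j
  period-^ {p} _ zero = sym (++-identityʳ p)
  period-^ {p} {u} {v} up≡pv (suc j) = begin
    (u ++ u ^ j) ++ p   ≡⟨ ++-assoc u (u ^ j) p ⟩
    u ++ (u ^ j ++ p)   ≡⟨ cong (u ++_) (period-^ up≡pv j) ⟩
    u ++ (p ++ v ^ j)   ≡⟨ ++-assoc u p (v ^ j) ⟨
    (u ++ p) ++ v ^ j   ≡⟨ cong (_++ v ^ j) up≡pv ⟩
    (p ++ v) ++ v ^ j   ≡⟨ ++-assoc p v (v ^ j) ⟩
    p ++ (v ++ v ^ j)   ∎
    where open ≡-Reasoning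

  period⇒border : ∀ {p U V : List A} → U ++ p ≡ p ++ V → length U ≤ length p
                → U ++ take (length p ∸ length U) p ≡ p
  period⇒border {p} {U} {V} Up≡pV U≤p = begin
    U ++ take (length p ∸ length U) p        ≡⟨ take-length+-++ U p _ ⟨
    take (length U + (length p ∸ length U)) (U ++ p)
                                             ≡⟨ cong₂ take (m+[n∸m]≡n U≤p) Up≡pV ⟩
    take (length p) (p ++ V)                 ≡⟨ take-length-++ p V ⟩
    p                                        ∎
    where open ≡-Reasoning

half-complement : ∀ {m n} → m ≤ n → n ≤ 2 * m → 2 * (n ∸ m) ≤ n
half-complement {m} {n} m≤n n≤2m = begin
  2 * (n ∸ m)        ≡⟨ cong ((n ∸ m) +_) (+-identityʳ (n ∸ m)) ⟩
  (n ∸ m) + (n ∸ m)  ≤⟨ +-monoʳ-≤ (n ∸ m) n∸m≤m ⟩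
  (n ∸ m) + m        ≡⟨ m∸n+n≡m m≤n ⟩
  n                  ∎
  where
  open ≤-Reasoning
  n∸m≤m : n ∸ m ≤ m
  n∸m≤m = ≤-trans (∸-monoˡ-≤ m n≤2m) (≤-reflexive (trans (m+n∸m≡n m (m + 0)) (+-identityʳ m)))

multiple-in-upper-half : ∀ {q n} → 0 < q → q < n → ∃ λ j → suc j * q < n × n ≤ 2 * (suc j * q)
multiple-in-upper-half {q} {n} 0<q q<n = search n 0 (subst (_< n) (sym (*-identityˡ q)) q<n) (m≤m+n n _)
  where
  search : ∀ t j → suc j * q < n → n ≤ t + suc j * q → ∃ λ j → suc j * q < n × n ≤ 2 * (suc j * q)
  search t j m<n n≤t+m with n ≤? 2 * (suc j * q)
  ... | yes n≤2m = j , m<n , n≤2m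
  search zero    j m<n n≤m     | no _ = contradiction n≤m (<⇒≱ m<n)
  search (suc t) j m<n n≤1+t+m | no n≰2m = search t (suc j) m′<n n≤t+m′
    where
    m = suc j * q
    m′<n : q + m < n
    m′<n = ≤-<-trans (≤-trans (+-monoˡ-≤ m (m≤m+n q (j * q))) (+-monoʳ-≤ m (m≤m+n m 0))) (≰⇒> n≰2m)
    n≤t+m′ : n ≤ t + (q + m)
    n≤t+m′ = ≤-trans n≤1+t+m (≤-trans (+-monoˡ-≤ m (+-monoˡ-≤ t 0<q))
                (≤-reflexive (trans (cong (_+ m) (+-comm q t)) (+-assoc t q m))))

module _ {k : ℕ} {p : Str k} where

  Property1-++ : ∀ {w} X → Property1 p w → Property1 p (w ++ X)
  Property1-++ {w} X (i , 0<i , i+n<w , close) =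
    i , 0<i , <-≤-trans i+n<w (length-++-≤ˡ w) ,
    subst (λ s → hamming s p ≤ 2) (sym (take-drop-++ˡ i (length p) w X (<⇒≤ i+n<w))) close

  Property1-^ : ∀ {u v} → u ++ p ≡ p ++ v → Property1 p (u ++ p) → ∀ j → Property1 p (u ^ suc j ++ p)
  Property1-^ {u} {v} up≡pv prop j =
    subst (Property1 p) (sym u^[1+j]p≡upX) (Property1-++ (v ^ j) prop)
    where
    u^[1+j]p≡upX : (u ++ u ^ j) ++ p ≡ (u ++ p) ++ v ^ j
    u^[1+j]p≡upX = trans (++-assoc u (u ^ j) p)
                     (trans (cong (u ++_) (period-^ up≡pv j)) (sym (++-assoc u p (v ^ j))))

  period⇒IsBorder : ∀ {U V} → U ++ p ≡ p ++ V → 0 < length U → length U < length p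
                  → IsBorder p (take (length p ∸ length U) p)
  period⇒IsBorder {U} {V} Up≡pV 0<U U<p =
    (λ b≡[] → <⇒≢ (m<n⇒0<n∸m U<p) (trans (sym (cong length b≡[])) |b|≡d)) ,
    (λ b≡p → <⇒≢ (∸-monoʳ-< 0<U (<⇒≤ U<p)) (trans (sym |b|≡d) (cong length b≡p))) ,
    (drop d p , take++drop≡id d p) ,
    (U , period⇒border Up≡pV (<⇒≤ U<p))
    where
    d = length p ∸ length U
    |b|≡d : length (take d p) ≡ d
    |b|≡d = length-take-≤ (m∸n≤m (length p) (length U))

  period⇒short-border : ∀ {u v} → u ++ p ≡ p ++ v → 0 < length u → length u < length p
    → Property1 p (u ++ p)
    → ∃ λ b′ → IsBorder p b′ × (2 * length b′ ≤ length p) × (∃ λ w′ → PB p b′ w′ × Property1 p w′)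
  period⇒short-border {u} {v} up≡pv 0<u u<p prop with multiple-in-upper-half 0<u u<p
  ... | j , m<n , n≤2m =
    take (length p ∸ length U) p , period⇒IsBorder Up≡pV 0<U U<p ,
    subst (λ d → 2 * d ≤ length p) (sym |b′|≡d) (half-complement (<⇒≤ U<p) n≤2U) ,
    U ++ p , (U , period⇒border Up≡pV (<⇒≤ U<p) , refl) , Property1-^ {u = u} {v} up≡pv prop j
    where
    U : Str k
    U = u ^ suc j
    Up≡pV : U ++ p ≡ p ++ v ^ suc j
    Up≡pV = period-^ {u = u} {v} up≡pv (suc j)
    |U|≡m : length U ≡ suc j * length u
    |U|≡m = length-^ u (suc j)
    U<p : length U < length p
    U<p = subst (_< length p) (sym |U|≡m) m<n
    n≤2U : length p ≤ 2 * length U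
    n≤2U = subst (λ m → length p ≤ 2 * m) (sym |U|≡m) n≤2m
    0<U : 0 < length U
    0<U = subst (0 <_) (sym |U|≡m) (≤-trans 0<u (m≤m+n (length u) _))
    |b′|≡d : length (take (length p ∸ length U) p) ≡ length p ∸ length U
    |b′|≡d = length-take-≤ (m∸n≤m (length p) (length U))

lemma6 : ∀ (k : ℕ) (p b : Str k) → IsBorder p b → length p < 2 * length b
    → (∃ λ w → PB p b w × Property1 p w)
    → ∃ λ b′ → IsBorder p b′ × (2 * length b′ ≤ length p)
    × (∃ λ w′ → PB p b′ w′ × Property1 p w′)
lemma6 k p b (b≢[] , b≢p , (v , bv≡p) , _) _ (w , (u , ub≡p , w≡up) , prop) =
  period⇒short-border {u = u} {v} (border⇒period {u = u} {v} bv≡p ub≡p) 0<u u<p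
    (subst (Property1 p) w≡up prop)
  where
  0<u : 0 < length u
  0<u = ≢[]⇒0<length λ u≡[] → b≢p (trans (cong (_++ b) (sym u≡[])) ub≡p)
  u<p : length u < length p
  u<p = subst (length u <_) (trans (sym (length-++ u)) (cong length ub≡p))
          (m<m+n (length u) (≢[]⇒0<length b≢[]))
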